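{- Let $\ell \in \mathbb{Z}_{\geq 0}$, $a, b \in \mathbb{Z}$, and $M = 2^eM_1$ with $e \in \mathbb{Z}_{\geq 1}$ and $M_1 \in \mathbb{Z}_{\geq 1}$ odd. Let $f = 0$ if $e = 1$ and $f = e$ if $e \geq 2$. Let $n \in \mathbb{Z}_{\geq 1}$ with $\gcd(n,M) = 1$. (1) If $a$ or $b$ is odd, then $\mu_{\ell, a, b, M}(n) = 0$. (2) If $a = 2a_1$ and $b = 2b_1$ with $a_1,b_1\in\mathbb{Z}$, then \[ \mu_{\ell,a,b,M}(n) = 2^\ell\sum_{\substack{d\mid n,\ d>0\\d<\sqrt{n}\\d \equiv a_1-b_1\pmod{2^{e-1}M_1}}}d^\ell \] if $n \equiv a_1^2-b_1^2 \pmod{2^fM_1}$, and $\mu_{\ell,a,b,M}(n) = 0$ otherwise.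
   Context: For $\ell \in \mathbb{Z}_{\geq 0}$, $a, b \in \mathbb{Z}$ and $M, n \in \mathbb{Z}_{\geq 1}$, define $\mu_{\ell, a, b, M}(n) := \sum (t-s)^\ell$, where the sum runs over integers $t>s\geq 1$ with $t^2-s^2=4n$, $t \equiv a \pmod{M}$, $s \equiv b \pmod{M}$. -}

module Defs where

open import Data.Nat as ℕ using (ℕ; zero; suc; _∸_; _^_)
import Data.Nat.Properties as ℕP
import Data.Nat.Divisibility as ℕD
open import Data.Integer as ℤ using (ℤ; +_)
import Data.Integer.Divisibility as ℤD
open import Data.List using (List; upTo; map; concatMap; filter)
open import Data.Nat.ListAction using (sum)
open import Data.Product using (_×_; _,_; proj₁; proj₂)
open import Relation.Nullary.Decidable using (Dec; _×-dec_)
open import Relation.Binary.PropositionalEquality using (_≡_)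

_≡_[mod_] : ℤ → ℤ → ℕ → Set
x ≡ y [mod m ] = ℤD._∣_ (+ m) (x ℤ.- y)

_≡?_[mod_] : (x y : ℤ) (m : ℕ) → Dec (x ≡ y [mod m ])
x ≡? y [mod m ] = ℕD._∣?_ m ℤ.∣ x ℤ.- y ∣

-- Every such pair has t ≤ t + s ≤ 4n,
-- so it suffices to search t ∈ [0, 4n], s ∈ [0, t).
μ-cond : ℤ → ℤ → ℕ → ℕ → ℕ × ℕ → Set
μ-cond a b M n (t , s) =
  (1 ℕ.≤ s) × ((s ℕ.< t) × ((t ℕ.* t ≡ s ℕ.* s ℕ.+ 4 ℕ.* n) ×
  (((+ t) ≡ a [mod M ]) × ((+ s) ≡ b [mod M ]))))

μ-cond? : ∀ a b M n p → Dec (μ-cond a b M n p)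
μ-cond? a b M n (t , s) =
  (1 ℕ.≤? s) ×-dec ((s ℕ.<? t) ×-dec ((t ℕ.* t ℕP.≟ s ℕ.* s ℕ.+ 4 ℕ.* n) ×-dec
  (((+ t) ≡? a [mod M ]) ×-dec ((+ s) ≡? b [mod M ]))))

μ-candidates : ℕ → List (ℕ × ℕ)
μ-candidates n = concatMap (λ t → map (λ s → (t , s)) (upTo t)) (upTo (suc (4 ℕ.* n)))

μ : ℕ → ℤ → ℤ → ℕ → ℕ → ℕ
μ ℓ a b M n =
  sum (map (λ p → (proj₁ p ∸ proj₂ p) ^ ℓ) (filter (μ-cond? a b M n) (μ-candidates n)))

div-cond : ℕ → ℤ → ℕ → ℕ → Set
div-cond n c K d = (1 ℕ.≤ d) × ((ℕD._∣_ d n) × ((d ℕ.* d ℕ.< n) × ((+ d) ≡ c [mod K ])))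

div-cond? : ∀ n c K d → Dec (div-cond n c K d)
div-cond? n c K d = (1 ℕ.≤? d) ×-dec ((ℕD._∣?_ d n) ×-dec ((d ℕ.* d ℕ.<? n) ×-dec ((+ d) ≡? c [mod K ])))

-- Σ_{d ∣ n, d > 0, d < √n, d ≡ c (mod K)} d^ℓ   (such d satisfy d ≤ n).
divSum : ℕ → ℕ → ℤ → ℕ → ℕ
divSum ℓ n c K = sum (map (λ d → d ^ ℓ) (filter (div-cond? n c K) (upTo (suc n))))

fexp : ℕ → ℕ
fexp 1 = 0
fexp e = e

-- Write K = 2^(e-1) M₁, so that M = 2K, and F = 2^f M₁.  As n is odd, every pair with
-- t² - s² = 4n has t = 2x, s = 2y, and d = x - y is a divisor of n with d² < n and cofactor
-- x + y, while (t - s)^ℓ = 2^ℓ d^ℓ; hence μ vanishes unless a, b are even.  For a = 2a₁,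
-- b = 2b₁ the congruences on t, s become x ≡ a₁, y ≡ b₁ (mod K), which force
-- n = x² - y² ≡ a₁² - b₁² (mod F) and d ≡ a₁ - b₁ (mod K).  Conversely, if
-- n ≡ a₁² - b₁² (mod F) and d ≡ a₁ - b₁ (mod K), then d · 2(x - a₁) ≡ 0 (mod F) with d prime
-- to F, which gives x ≡ a₁ (mod K) back; so (t , s) ↦ (t - s)/2 is a bijection from the
-- pairs counted by μ onto the divisors counted by divSum.

module Submission where

open import Defs
open import Data.Nat as ℕ using (ℕ; _^_; _≤_)
open import Data.Nat.GCD using (gcd)
import Data.Nat.Divisibility as ℕD
open import Data.Integer as ℤ using (ℤ; +_)
import Data.Integer.Divisibility as ℤD
open import Data.Product using (_×_)
open import Data.Sum using (_⊎_)
open import Relation.Nullary using (¬_)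
open import Relation.Binary.PropositionalEquality using (_≡_)

open import Data.Nat
  using (zero; suc; _+_; _*_; _∸_; _<_; ⌊_/2⌋; NonZero; ≢-nonZero; >-nonZero⁻¹; z≤n; s≤s)
open import Data.Nat.Properties
open import Data.Nat.Divisibility
  using (_∣_; divides; ∣-refl; ∣-trans; _∣0; ∣⇒≤; m∣m*n; n∣m*n; ∣m∣n⇒∣m+n; ∣m+n∣m⇒∣n;
         *-cancelˡ-∣; *-monoʳ-∣)
open import Data.Nat.Coprimality using (Coprime; coprime-divisor; gcd≡1⇒coprime)
import Data.Nat.Coprimality as Coprimality
open import Data.Nat.Primality using (irreducible[2])
import Data.Nat.Tactic.RingSolver as ℕ-Solver
open import Data.Integer.Properties using (abs-*; pos-+; pos-*)
import Data.Integer.Divisibility.Signed as ℤˢ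
import Data.Integer.Coprimality as ℤᶜ
import Data.Integer.Tactic.RingSolver as ℤ-Solver
open import Data.Product using (_,_; proj₁; proj₂; ∃₂; ∃-syntax)
open import Data.Sum using (inj₁; inj₂; [_,_])
open import Data.List using (List; []; _∷_; map; filter; upTo)
open import Data.List.Properties using (map-∘; map-cong-local; filter-none)
open import Data.List.Membership.Propositional using (_∈_; lose)
open import Data.List.Membership.Propositional.Properties
  using (∈-map⁺; ∈-map⁻; ∈-concatMap⁺; ∈-upTo⁺; ∈-filter⁺; ∈-filter⁻)
open import Data.List.Membership.Propositional.Properties.WithK using (unique∧set⇒bag)
open import Data.List.Relation.Binary.BagAndSetEquality using (∼bag⇒↭)
import Data.List.Relation.Binary.Permutation.Propositional.Properties as ↭
open import Data.List.Relation.Unary.All as All using (All)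
import Data.List.Relation.Unary.All.Properties as All
open import Data.List.Relation.Unary.Any using (here; there)
import Data.List.Relation.Unary.AllPairs as AllPairs
import Data.List.Relation.Unary.AllPairs.Properties as AllPairs
open import Data.List.Relation.Unary.Unique.Propositional using (Unique)
import Data.List.Relation.Unary.Unique.Propositional.Properties as Unique
open import Data.Nat.ListAction using (sum)
open import Data.Nat.ListAction.Properties using (sum-↭)
open import Function using (_∘_; it; mk⇔)
open import Relation.Nullary using (contradiction)
open import Relation.Binary.PropositionalEquality
  using (_≢_; refl; sym; trans; cong; cong₂; subst; module ≡-Reasoning)

even⊎odd : ∀ m → (∃[ k ] m ≡ 2 * k) ⊎ (∃[ k ] m ≡ 1 + 2 * k)
even⊎odd zero = inj₁ (0 , refl)
even⊎odd (suc m) with even⊎odd m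
... | inj₁ (k , refl) = inj₂ (k , refl)
... | inj₂ (k , refl) = inj₁ (suc k , cong suc (sym (+-suc k (k + 0))))

2∣m*[1+m] : ∀ m → 2 ∣ m * suc m
2∣m*[1+m] zero    = 2 ∣0
2∣m*[1+m] (suc m) = subst (2 ∣_) (step m) (∣m∣n⇒∣m+n (2∣m*[1+m] m) (m∣m*n (suc m)))
  where
  step : ∀ m → m * suc m + 2 * suc m ≡ suc m * suc (suc m)
  step = ℕ-Solver.solve-∀

t*t≡s*s+4*n⇒2∣t×2∣s : ∀ {t s n} → ¬ 2 ∣ n → t * t ≡ s * s + 4 * n → 2 ∣ t × 2 ∣ s
t*t≡s*s+4*n⇒2∣t×2∣s {t} {s} {n} n-odd eq with even⊎odd t | even⊎odd s
... | inj₁ (x , refl) | inj₁ (y , refl) = m∣m*n x , m∣m*n y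
... | inj₁ (x , refl) | inj₂ (y , refl) =
  contradiction (trans (sym (even x)) (trans eq (odd y n))) (even≢odd (2 * x * x) (2 * y * suc y + 2 * n))
  where
  even : ∀ x → 2 * x * (2 * x) ≡ 2 * (2 * x * x)
  even = ℕ-Solver.solve-∀
  odd : ∀ y n → (1 + 2 * y) * (1 + 2 * y) + 4 * n ≡ 1 + 2 * (2 * y * suc y + 2 * n)
  odd = ℕ-Solver.solve-∀
... | inj₂ (x , refl) | inj₁ (y , refl) =
  contradiction (trans (sym (even y n)) (trans (sym eq) (odd x))) (even≢odd (2 * y * y + 2 * n) (2 * x * suc x))
  where
  even : ∀ y n → 2 * y * (2 * y) + 4 * n ≡ 2 * (2 * y * y + 2 * n)
  even = ℕ-Solver.solve-∀
  odd : ∀ x → (1 + 2 * x) * (1 + 2 * x) ≡ 1 + 2 * (2 * x * suc x)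
  odd = ℕ-Solver.solve-∀
-- odd squares are 1 modulo 8
... | inj₂ (x , refl) | inj₂ (y , refl) =
  contradiction (∣m+n∣m⇒∣n (subst (2 ∣_) x*[1+x]≡ (2∣m*[1+m] x)) (2∣m*[1+m] y)) n-odd
  where
  odd² : ∀ x → (1 + 2 * x) * (1 + 2 * x) ≡ 1 + 4 * (x * suc x)
  odd² = ℕ-Solver.solve-∀
  odd²+4n : ∀ y n → (1 + 2 * y) * (1 + 2 * y) + 4 * n ≡ 1 + 4 * (y * suc y + n)
  odd²+4n = ℕ-Solver.solve-∀
  x*[1+x]≡ : x * suc x ≡ y * suc y + n
  x*[1+x]≡ = *-cancelˡ-≡ _ _ 4 (suc-injective (trans (sym (odd² x)) (trans eq (odd²+4n y n))))

-- The cofactor q of d is d + r with (2d + r)² = r² + 4n, so r is even.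
odd⇒q≡d+2*y : ∀ {n d q} → ¬ 2 ∣ n → n ≡ q * d → d < q → ∃[ y ] 1 ≤ y × q ≡ d + 2 * y
odd⇒q≡d+2*y {n} {d} n-odd n≡q*d d<q with k , refl ← m≤n⇒∃[o]m+o≡n d<q
  with t*t≡s*s+4*n⇒2∣t×2∣s {2 * d + suc k} {suc k} n-odd
         (trans (square d k) (cong (λ m → suc k * suc k + 4 * m) (sym n≡q*d)))
  where
  square : ∀ d k → (2 * d + suc k) * (2 * d + suc k) ≡ suc k * suc k + 4 * ((suc d + k) * d)
  square = ℕ-Solver.solve-∀
... | _ , divides (suc y) 1+k≡y*2 =
  suc y , s≤s z≤n , trans (sym (+-suc d k)) (cong (_+_ d) (trans 1+k≡y*2 (*-comm (suc y) 2)))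

d*[d+2*y]-injective : ∀ d {y y′} .{{_ : NonZero d}} → d * (d + 2 * y) ≡ d * (d + 2 * y′) → y ≡ y′
d*[d+2*y]-injective d {y} {y′} = *-cancelˡ-≡ y y′ 2 ∘ +-cancelˡ-≡ d _ _ ∘ *-cancelˡ-≡ _ _ d

^-distribʳ-* : ∀ m n ℓ → (m * n) ^ ℓ ≡ m ^ ℓ * n ^ ℓ
^-distribʳ-* m n zero    = refl
^-distribʳ-* m n (suc ℓ) = trans (cong (m * n *_) (^-distribʳ-* m n ℓ)) (interchange m n (m ^ ℓ) (n ^ ℓ))
  where
  interchange : ∀ m n a b → m * n * (a * b) ≡ m * a * (n * b)
  interchange = ℕ-Solver.solve-∀

odd⇒coprime-2 : ∀ {m} → ¬ 2 ∣ m → Coprime m 2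
odd⇒coprime-2 m-odd (i∣m , i∣2) with irreducible[2] i∣2
... | inj₁ i≡1 = i≡1
... | inj₂ refl = contradiction i∣m m-odd

coprime-divisors : ∀ {m n i j} → Coprime m n → i ∣ m → j ∣ n → Coprime i j
coprime-divisors m⊥n i∣m j∣n (k∣i , k∣j) = m⊥n (∣-trans k∣i i∣m , ∣-trans k∣j j∣n)

coprime-2*K⇒odd : ∀ {n K} → Coprime n (2 * K) → ¬ 2 ∣ n
coprime-2*K⇒odd {K = K} n⊥2K 2∣n with () ← n⊥2K (2∣n , m∣m*n K)

Unique-map⁺-local : ∀ {A B : Set} {f : A → B} {xs : List A} →
                    (∀ {x x′} → x ∈ xs → x′ ∈ xs → f x ≡ f x′ → x ≡ x′) → Unique xs → Unique (map f xs)
Unique-map⁺-local f-inj AllPairs.[] = AllPairs.[]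
Unique-map⁺-local f-inj (x∉xs AllPairs.∷ xs!) =
  All.map⁺ (All.tabulate λ x′∈xs → All.lookup x∉xs x′∈xs ∘ f-inj (here refl) (there x′∈xs))
  AllPairs.∷ Unique-map⁺-local (λ x∈ x′∈ → f-inj (there x∈) (there x′∈)) xs!

sum-map-reindex : ∀ {A B : Set} {xs : List A} {ys : List B} (ψ : A → B) (f : B → ℕ) →
                  Unique xs → Unique ys → (∀ {x x′} → x ∈ xs → x′ ∈ xs → ψ x ≡ ψ x′ → x ≡ x′) →
                  (∀ {x} → x ∈ xs → ψ x ∈ ys) → (∀ {y} → y ∈ ys → ∃[ x ] x ∈ xs × ψ x ≡ y) →
                  sum (map (f ∘ ψ) xs) ≡ sum (map f ys)
sum-map-reindex {xs = xs} {ys} ψ f xs! ys! ψ-inj ψ-into ψ-onto = begin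
  sum (map (f ∘ ψ) xs)   ≡⟨ cong sum (map-∘ xs) ⟩
  sum (map f (map ψ xs)) ≡⟨ sum-↭ (↭.map⁺ f (∼bag⇒↭ (unique∧set⇒bag ψxs! ys! (mk⇔ into onto)))) ⟩
  sum (map f ys)         ∎
  where
  open ≡-Reasoning
  ψxs! = Unique-map⁺-local ψ-inj xs!
  into : ∀ {y} → y ∈ map ψ xs → y ∈ ys
  into y∈ with _ , x∈ , refl ← ∈-map⁻ ψ y∈ = ψ-into x∈
  onto : ∀ {y} → y ∈ ys → y ∈ map ψ xs
  onto y∈ with _ , x∈ , refl ← ψ-onto y∈ = ∈-map⁺ ψ x∈

*-distribˡ-sum : ∀ {A : Set} c (f : A → ℕ) xs → c * sum (map f xs) ≡ sum (map (λ x → c * f x) xs)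
*-distribˡ-sum c f []       = *-zeroʳ c
*-distribˡ-sum c f (x ∷ xs) =
  trans (*-distribˡ-+ c (f x) _) (cong (λ s → c * f x + s) (*-distribˡ-sum c f xs))

∈-μ-candidates : ∀ {n t s} → s < t → t ≤ 4 * n → (t , s) ∈ μ-candidates n
∈-μ-candidates s<t t≤4n =
  ∈-concatMap⁺ (λ t → map (t ,_) (upTo t)) (lose (∈-upTo⁺ (s≤s t≤4n)) (∈-map⁺ (_ ,_) (∈-upTo⁺ s<t)))

Unique-μ-candidates : ∀ n → Unique (μ-candidates n)
Unique-μ-candidates n = Unique.concat⁺
  (All.map⁺ (All.tabulate λ {t} _ → Unique.map⁺ (cong proj₂) (Unique.upTo⁺ t)))
  (AllPairs.map⁺ (AllPairs.map disjoint (Unique.upTo⁺ (suc (4 * n)))))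
  where
  disjoint : ∀ {t t′} → t ≢ t′ → ∀ {p} → ¬ (p ∈ map (t ,_) (upTo t) × p ∈ map (t′ ,_) (upTo t′))
  disjoint t≢t′ (p∈ , p∈′) with _ , _ , refl ← ∈-map⁻ _ p∈ | _ , _ , eq ← ∈-map⁻ _ p∈′ =
    t≢t′ (cong proj₁ eq)

-- Modulo F, x² depends only on x mod K, as (x + uK)² = x² + 2K·ux + K²·u².  For K = 2^(e-1) M₁
-- the theorem's F = 2^f M₁ is such a modulus: f = 0 or e according as K is odd or even.
record SquareModulus (K F : ℕ) : Set where
  field
    ∣2*K     : F ∣ 2 * K
    ∣K*K     : F ∣ K * K
    ∣2*w⇒K∣w : ∀ {w} → F ∣ 2 * w → K ∣ w

odd⇒SquareModulus : ∀ {K} → ¬ 2 ∣ K → SquareModulus K K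
odd⇒SquareModulus {K} K-odd = record
  { ∣2*K     = n∣m*n 2
  ; ∣K*K     = m∣m*n K
  ; ∣2*w⇒K∣w = coprime-divisor (odd⇒coprime-2 K-odd)
  }

even⇒SquareModulus : ∀ {K} → 2 ∣ K → SquareModulus K (2 * K)
even⇒SquareModulus (divides k refl) = record
  { ∣2*K     = ∣-refl
  ; ∣K*K     = divides k (square k)
  ; ∣2*w⇒K∣w = *-cancelˡ-∣ 2
  }
  where
  square : ∀ k → k * 2 * (k * 2) ≡ k * (2 * (k * 2))
  square = ℕ-Solver.solve-∀

SquareModulus-2^e*M₁ : ∀ e {M₁} → ¬ 2 ∣ M₁ → SquareModulus (2 ^ e * M₁) (2 ^ fexp (suc e) * M₁)
SquareModulus-2^e*M₁ zero    M₁-odd = odd⇒SquareModulus (M₁-odd ∘ subst (2 ∣_) (*-identityˡ _))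
SquareModulus-2^e*M₁ (suc e) {M₁} M₁-odd = subst (SquareModulus _) (sym (*-assoc 2 (2 ^ suc e) M₁))
  (even⇒SquareModulus (∣-trans (m∣m*n (2 ^ e)) (m∣m*n M₁)))

≡-mod⇒∣ˢ : ∀ {x y m} → x ≡ y [mod m ] → + m ℤˢ.∣ x ℤ.- y
≡-mod⇒∣ˢ {x} {y} {m} = ℤˢ.∣ᵤ⇒∣ {+ m} {x ℤ.- y}

∣ˢ⇒≡-mod : ∀ {x y m} → + m ℤˢ.∣ x ℤ.- y → x ≡ y [mod m ]
∣ˢ⇒≡-mod = ℤˢ.∣⇒∣ᵤ

∣-resp-≡-mod : ∀ {m M x y} → m ∣ M → x ≡ y [mod M ] → ℤD._∣_ (+ m) x → ℤD._∣_ (+ m) y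
∣-resp-≡-mod {m} {M} {x} {y} m∣M x≡y m∣x = ℤˢ.∣⇒∣ᵤ (subst (+ m ℤˢ.∣_) (x-[x-y]≡y x y)
  (ℤˢ.∣m∣n⇒∣m-n (ℤˢ.∣ᵤ⇒∣ {+ m} {x} m∣x)
                 (ℤˢ.∣-trans (ℤˢ.∣ᵤ⇒∣ {+ m} {+ M} m∣M) (≡-mod⇒∣ˢ {x} {y} x≡y))))
  where
  x-[x-y]≡y : ∀ x y → x ℤ.- (x ℤ.- y) ≡ y
  x-[x-y]≡y = ℤ-Solver.solve-∀

∣+[k*m]-k*a∣≡k*∣+m-a∣ : ∀ k m a → ℤ.∣ + (k * m) ℤ.- + k ℤ.* a ∣ ≡ k * ℤ.∣ + m ℤ.- a ∣
∣+[k*m]-k*a∣≡k*∣+m-a∣ k m a = begin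
  ℤ.∣ + (k * m) ℤ.- + k ℤ.* a ∣   ≡⟨ cong (λ z → ℤ.∣ z ℤ.- + k ℤ.* a ∣) (pos-* k m) ⟩
  ℤ.∣ + k ℤ.* + m ℤ.- + k ℤ.* a ∣ ≡⟨ cong ℤ.∣_∣ (distrib (+ k) (+ m) a) ⟩
  ℤ.∣ + k ℤ.* (+ m ℤ.- a) ∣       ≡⟨ abs-* (+ k) _ ⟩
  k * ℤ.∣ + m ℤ.- a ∣             ∎
  where
  open ≡-Reasoning
  distrib : ∀ k m a → k ℤ.* m ℤ.- k ℤ.* a ≡ k ℤ.* (m ℤ.- a)
  distrib = ℤ-Solver.solve-∀

*-cancel-≡-mod : ∀ k {m K a} .{{_ : NonZero k}} →
                 (+ (k * m)) ≡ + k ℤ.* a [mod k * K ] → (+ m) ≡ a [mod K ]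
*-cancel-≡-mod k {m} {K} {a} = *-cancelˡ-∣ k ∘ subst (k * K ∣_) (∣+[k*m]-k*a∣≡k*∣+m-a∣ k m a)

*-mono-≡-mod : ∀ k {m K a} → (+ m) ≡ a [mod K ] → (+ (k * m)) ≡ + k ℤ.* a [mod k * K ]
*-mono-≡-mod k {m} {K} {a} = subst (k * K ∣_) (sym (∣+[k*m]-k*a∣≡k*∣+m-a∣ k m a)) ∘ *-monoʳ-∣ k

x+y≡a∧y≡b⇒x≡a-b : ∀ {x y a b K} → (x ℤ.+ y) ≡ a [mod K ] → y ≡ b [mod K ] → x ≡ a ℤ.- b [mod K ]
x+y≡a∧y≡b⇒x≡a-b {x} {y} {a} {b} {K} x+y≡a y≡b =
  ∣ˢ⇒≡-mod {x} {a ℤ.- b} (subst (+ K ℤˢ.∣_) (identity x y a b)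
    (ℤˢ.∣m∣n⇒∣m-n (≡-mod⇒∣ˢ {x ℤ.+ y} {a} x+y≡a) (≡-mod⇒∣ˢ {y} {b} y≡b)))
  where
  identity : ∀ x y a b → (x ℤ.+ y ℤ.- a) ℤ.- (y ℤ.- b) ≡ x ℤ.- (a ℤ.- b)
  identity = ℤ-Solver.solve-∀

x+y≡a∧x≡a-b⇒y≡b : ∀ {x y a b K} → (x ℤ.+ y) ≡ a [mod K ] → x ≡ a ℤ.- b [mod K ] → y ≡ b [mod K ]
x+y≡a∧x≡a-b⇒y≡b {x} {y} {a} {b} {K} x+y≡a x≡a-b =
  ∣ˢ⇒≡-mod {y} {b} (subst (+ K ℤˢ.∣_) (identity x y a b)
    (ℤˢ.∣m∣n⇒∣m-n (≡-mod⇒∣ˢ {x ℤ.+ y} {a} x+y≡a) (≡-mod⇒∣ˢ {x} {a ℤ.- b} x≡a-b)))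
  where
  identity : ∀ x y a b → (x ℤ.+ y ℤ.- a) ℤ.- (x ℤ.- (a ℤ.- b)) ≡ y ℤ.- b
  identity = ℤ-Solver.solve-∀

module _ {K F : ℕ} (F-sq : SquareModulus K F) where
  open SquareModulus F-sq

  private
    F∣u*u+2*u*w : ∀ {u} w → + K ℤˢ.∣ u → + F ℤˢ.∣ u ℤ.* u ℤ.+ + 2 ℤ.* u ℤ.* w
    F∣u*u+2*u*w {u} w K∣u = ℤˢ.∣m∣n⇒∣m+n
      (ℤˢ.∣-trans F∣K*K (ℤˢ.∣-trans (ℤˢ.*-monoʳ-∣ (+ K) K∣u) (ℤˢ.*-monoˡ-∣ u K∣u)))
      (ℤˢ.∣m⇒∣m*n w (ℤˢ.∣-trans F∣2*K (ℤˢ.*-monoʳ-∣ (+ 2) K∣u)))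
      where
      F∣K*K : + F ℤˢ.∣ + K ℤ.* + K
      F∣K*K = ℤˢ.∣ᵤ⇒∣ (subst (F ∣_) (sym (abs-* (+ K) (+ K))) ∣K*K)
      F∣2*K : + F ℤˢ.∣ + 2 ℤ.* + K
      F∣2*K = ℤˢ.∣ᵤ⇒∣ (subst (F ∣_) (sym (abs-* (+ 2) (+ K))) ∣2*K)

  ≡-mod-difference-of-squares : ∀ {d y a b} → (d ℤ.+ y) ≡ a [mod K ] → y ≡ b [mod K ] →
                                (d ℤ.* (d ℤ.+ + 2 ℤ.* y)) ≡ a ℤ.* a ℤ.- b ℤ.* b [mod F ]
  ≡-mod-difference-of-squares {d} {y} {a} {b} d+y≡a y≡b =
    ∣ˢ⇒≡-mod {d ℤ.* (d ℤ.+ + 2 ℤ.* y)} (subst (+ F ℤˢ.∣_) (sym (identity d y a b))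
      (ℤˢ.∣m∣n⇒∣m-n (F∣u*u+2*u*w a (≡-mod⇒∣ˢ {d ℤ.+ y} {a} d+y≡a))
                     (F∣u*u+2*u*w b (≡-mod⇒∣ˢ {y} {b} y≡b))))
    where
    identity : ∀ d y a b → d ℤ.* (d ℤ.+ + 2 ℤ.* y) ℤ.- (a ℤ.* a ℤ.- b ℤ.* b) ≡
      ((d ℤ.+ y ℤ.- a) ℤ.* (d ℤ.+ y ℤ.- a) ℤ.+ + 2 ℤ.* (d ℤ.+ y ℤ.- a) ℤ.* a) ℤ.-
      ((y ℤ.- b) ℤ.* (y ℤ.- b) ℤ.+ + 2 ℤ.* (y ℤ.- b) ℤ.* b)
    identity = ℤ-Solver.solve-∀

  -- By the identity below d · 2((d + y) - a) ≡ 0 (mod F), and d is a unit modulo F.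
  ≡-mod-difference-of-squares⁻¹ : ∀ {d y a b} → Coprime F ℤ.∣ d ∣ → d ≡ a ℤ.- b [mod K ] →
                                  (d ℤ.* (d ℤ.+ + 2 ℤ.* y)) ≡ a ℤ.* a ℤ.- b ℤ.* b [mod F ] →
                                  (d ℤ.+ y) ≡ a [mod K ]
  ≡-mod-difference-of-squares⁻¹ {d} {y} {a} {b} F⊥d d≡a-b d*[d+2y]≡ =
    ∣2*w⇒K∣w (subst (F ∣_) (abs-* (+ 2) (d ℤ.+ y ℤ.- a))
      (ℤᶜ.coprime-divisor (+ F) d (+ 2 ℤ.* (d ℤ.+ y ℤ.- a)) F⊥d (ℤˢ.∣⇒∣ᵤ F∣d*2w)))
    where
    identity : ∀ d y a b → d ℤ.* (+ 2 ℤ.* (d ℤ.+ y ℤ.- a)) ≡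
      (d ℤ.* (d ℤ.+ + 2 ℤ.* y) ℤ.- (a ℤ.* a ℤ.- b ℤ.* b)) ℤ.+
      ((d ℤ.- (a ℤ.- b)) ℤ.* (d ℤ.- (a ℤ.- b)) ℤ.+ + 2 ℤ.* (d ℤ.- (a ℤ.- b)) ℤ.* ℤ.- b)
    identity = ℤ-Solver.solve-∀
    F∣d*2w : + F ℤˢ.∣ d ℤ.* (+ 2 ℤ.* (d ℤ.+ y ℤ.- a))
    F∣d*2w = subst (+ F ℤˢ.∣_) (sym (identity d y a b))
      (ℤˢ.∣m∣n⇒∣m+n (≡-mod⇒∣ˢ {d ℤ.* (d ℤ.+ + 2 ℤ.* y)} d*[d+2y]≡)
                    (F∣u*u+2*u*w (ℤ.- b) (≡-mod⇒∣ˢ {d} {a ℤ.- b} d≡a-b)))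

pair : ℕ → ℕ → ℕ × ℕ
pair d y = 2 * (d + y) , 2 * y

pair-difference : ∀ d y → 2 * (d + y) ∸ 2 * y ≡ 2 * d
pair-difference d y = trans (cong (_∸ 2 * y) (*-distribˡ-+ 2 d y)) (m+n∸n≡m (2 * d) (2 * y))

⌊pair-difference/2⌋ : ∀ d y → ⌊ 2 * (d + y) ∸ 2 * y /2⌋ ≡ d
⌊pair-difference/2⌋ d y =
  trans (cong ⌊_/2⌋ (trans (pair-difference d y) (cong (_+_ d) (+-identityʳ d)))) (sym (n≡⌊n+n/2⌋ d))

pair-square : ∀ d y → 2 * (d + y) * (2 * (d + y)) ≡ 2 * y * (2 * y) + 4 * (d * (d + 2 * y))
pair-square = ℕ-Solver.solve-∀

t*t≡s*s+4*n⇒pair : ∀ {n t s} → ¬ 2 ∣ n → s < t → t * t ≡ s * s + 4 * n → ∃₂ λ d y → (t , s) ≡ pair d y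
t*t≡s*s+4*n⇒pair {n} {t} {s} n-odd s<t eq with t*t≡s*s+4*n⇒2∣t×2∣s {t} {s} n-odd eq
... | divides x refl , divides y refl = x ∸ y , y , cong₂ _,_ t≡ (*-comm y 2)
  where
  y≤x : y ≤ x
  y≤x = <⇒≤ (*-cancelʳ-< 2 y x s<t)
  t≡ : x * 2 ≡ 2 * (x ∸ y + y)
  t≡ = trans (*-comm x 2) (cong (2 *_) (sym (m∸n+n≡m y≤x)))

-- The conditions of μ-cond (2a) (2b) (2K) n on pair d y = (2x , 2y), x = d + y, halved.
record HalfPair (a b : ℤ) (K n d y : ℕ) : Set where
  field
    y≥1   : 1 ≤ y
    n≡    : n ≡ d * (d + 2 * y)
    d+y≡a : (+ (d + y)) ≡ a [mod K ]
    y≡b   : (+ y) ≡ b [mod K ]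

μ-cond⇒HalfPair : ∀ {a b K n d y} →
                  μ-cond (+ 2 ℤ.* a) (+ 2 ℤ.* b) (2 * K) n (pair d y) → HalfPair a b K n d y
μ-cond⇒HalfPair {a} {b} {K} {d = d} {y} (2y≥1 , _ , eq , t≡2a , s≡2b) = record
  { y≥1   = 1≤2*y⇒1≤y 2y≥1
  ; n≡    = *-cancelˡ-≡ _ _ 4 (+-cancelˡ-≡ (2 * y * (2 * y)) _ _ (trans (sym eq) (pair-square d y)))
  ; d+y≡a = *-cancel-≡-mod 2 {d + y} {K} {a} t≡2a
  ; y≡b   = *-cancel-≡-mod 2 {y} {K} {b} s≡2b
  }
  where
  1≤2*y⇒1≤y : ∀ {y} → 1 ≤ 2 * y → 1 ≤ y
  1≤2*y⇒1≤y {suc y} _ = s≤s z≤n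

module _ {a b : ℤ} {K n d y : ℕ} .{{_ : NonZero n}} (h : HalfPair a b K n d y) where
  open HalfPair h

  HalfPair⇒nonZero : NonZero d
  HalfPair⇒nonZero = m*n≢0⇒m≢0 d {{subst NonZero n≡ it}}

  private
    instance _ = HalfPair⇒nonZero
    d<d+2*y : d < d + 2 * y
    d<d+2*y = m<m+n d (≤-trans y≥1 (m≤n*m y 2))

  HalfPair⇒μ-cond : μ-cond (+ 2 ℤ.* a) (+ 2 ℤ.* b) (2 * K) n (pair d y)
  HalfPair⇒μ-cond =
    ≤-trans y≥1 (m≤n*m y 2) ,
    *-monoʳ-< 2 (m<n+m y (>-nonZero⁻¹ d)) ,
    trans (pair-square d y) (cong (λ m → 2 * y * (2 * y) + 4 * m) (sym n≡)) ,
    *-mono-≡-mod 2 {d + y} {K} {a} d+y≡a ,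
    *-mono-≡-mod 2 {y} {K} {b} y≡b

  HalfPair⇒div-cond : div-cond n (a ℤ.- b) K d
  HalfPair⇒div-cond =
    >-nonZero⁻¹ d ,
    divides (d + 2 * y) (trans n≡ (*-comm d _)) ,
    subst (d * d <_) (sym n≡) (*-monoʳ-< d d<d+2*y) ,
    x+y≡a∧y≡b⇒x≡a-b {+ d} {+ y} {a} {b} {K} (subst (λ z → z ≡ a [mod K ]) (pos-+ d y) d+y≡a) y≡b

  pair-bound : 2 * (d + y) ≤ 4 * n
  pair-bound = begin
    2 * (d + y)           ≤⟨ *-mono-≤ (m≤m+n 2 2) (+-monoʳ-≤ d (m≤n*m y 2)) ⟩
    4 * (d + 2 * y)       ≤⟨ *-monoʳ-≤ 4 (m≤n*m (d + 2 * y) d) ⟩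
    4 * (d * (d + 2 * y)) ≡⟨ cong (4 *_) (sym n≡) ⟩
    4 * n                 ∎
    where open ≤-Reasoning

pos-d*[d+2*y] : ∀ d y → + (d * (d + 2 * y)) ≡ + d ℤ.* (+ d ℤ.+ + 2 ℤ.* + y)
pos-d*[d+2*y] d y =
  trans (pos-* d _) (cong (+ d ℤ.*_) (trans (pos-+ d _) (cong (λ z → + d ℤ.+ z) (pos-* 2 y))))

module _ {K F : ℕ} (F-sq : SquareModulus K F) {a b : ℤ} {n d : ℕ} where
  open SquareModulus F-sq

  HalfPair⇒n≡a*a-b*b : ∀ {y} → HalfPair a b K n d y → (+ n) ≡ a ℤ.* a ℤ.- b ℤ.* b [mod F ]
  HalfPair⇒n≡a*a-b*b {y} h =
    subst (λ z → z ≡ a ℤ.* a ℤ.- b ℤ.* b [mod F ]) (sym (trans (cong +_ n≡) (pos-d*[d+2*y] d y)))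
      (≡-mod-difference-of-squares F-sq {+ d} {+ y} {a} {b}
        (subst (λ z → z ≡ a [mod K ]) (pos-+ d y) d+y≡a) y≡b)
    where open HalfPair h

  div-cond⇒HalfPair : Coprime n (2 * K) → (+ n) ≡ a ℤ.* a ℤ.- b ℤ.* b [mod F ] →
                      div-cond n (a ℤ.- b) K d → ∃[ y ] HalfPair a b K n d y
  div-cond⇒HalfPair n⊥2K n≡a*a-b*b (_ , d∣n@(divides q n≡q*d) , d*d<n , d≡a-b)
    with y , y≥1 , refl ← odd⇒q≡d+2*y (coprime-2*K⇒odd {K = K} n⊥2K) n≡q*d
                            (*-cancelʳ-< d d q (subst (d * d <_) n≡q*d d*d<n)) =
    y , record
      { y≥1   = y≥1
      ; n≡    = n≡
      ; d+y≡a = subst (λ z → z ≡ a [mod K ]) (sym (pos-+ d y)) d+y≡a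
      ; y≡b   = x+y≡a∧x≡a-b⇒y≡b {+ d} {+ y} {a} {b} {K} d+y≡a d≡a-b
      }
    where
    n≡ : n ≡ d * (d + 2 * y)
    n≡ = trans n≡q*d (*-comm _ d)
    F⊥d : Coprime F d
    F⊥d = Coprimality.sym (coprime-divisors n⊥2K d∣n ∣2*K)
    d+y≡a : (+ d ℤ.+ + y) ≡ a [mod K ]
    d+y≡a = ≡-mod-difference-of-squares⁻¹ F-sq {+ d} {+ y} {a} {b} F⊥d d≡a-b
      (subst (λ z → z ≡ a ℤ.* a ℤ.- b ℤ.* b [mod F ]) (trans (cong +_ n≡) (pos-d*[d+2*y] d y)) n≡a*a-b*b)

no-μ-pair⇒μ≡0 : ∀ ℓ a b M n → (∀ {p} → ¬ μ-cond a b M n p) → μ ℓ a b M n ≡ 0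
no-μ-pair⇒μ≡0 ℓ a b M n no-pair = cong (sum ∘ map (λ p → (proj₁ p ∸ proj₂ p) ^ ℓ))
  (filter-none (μ-cond? a b M n) {μ-candidates n} (All.tabulate λ _ → no-pair))

μ-odd-residue≡0 : ∀ {K n} → Coprime n (2 * K) →
                  ∀ ℓ a b → ¬ ℤD._∣_ (+ 2) a ⊎ ¬ ℤD._∣_ (+ 2) b → μ ℓ a b (2 * K) n ≡ 0
μ-odd-residue≡0 {K} {n} n⊥2K ℓ a b a∨b-odd = no-μ-pair⇒μ≡0 ℓ a b (2 * K) n no-pair
  where
  no-pair : ∀ {p} → ¬ μ-cond a b (2 * K) n p
  no-pair {t , s} (_ , _ , eq , t≡a , s≡b)
    with 2∣t , 2∣s ← t*t≡s*s+4*n⇒2∣t×2∣s {t} {s} (coprime-2*K⇒odd {K = K} n⊥2K) eq =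
    [ (λ a-odd → a-odd (∣-resp-≡-mod {x = + t} {a} (m∣m*n K) t≡a 2∣t))
    , (λ b-odd → b-odd (∣-resp-≡-mod {x = + s} {b} (m∣m*n K) s≡b 2∣s))
    ] a∨b-odd

module _ {K F n : ℕ} (F-sq : SquareModulus K F) (n⊥2K : Coprime n (2 * K)) (a b : ℤ) where
  private
    n-odd : ¬ 2 ∣ n
    n-odd = coprime-2*K⇒odd {K = K} n⊥2K

    instance
      n≢0 : NonZero n
      n≢0 = ≢-nonZero λ { refl → n-odd (2 ∣0) }

    pair-cond? = μ-cond? (+ 2 ℤ.* a) (+ 2 ℤ.* b) (2 * K) n
    divisor-cond? = div-cond? n (a ℤ.- b) K

    pairs : List (ℕ × ℕ)
    pairs = filter pair-cond? (μ-candidates n)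

    divisors : List ℕ
    divisors = filter divisor-cond? (upTo (suc n))

    Unique-pairs : Unique pairs
    Unique-pairs = Unique.filter⁺ pair-cond? (Unique-μ-candidates n)

    Unique-divisors : Unique divisors
    Unique-divisors = Unique.filter⁺ divisor-cond? (Unique.upTo⁺ (suc n))

    half-difference : ℕ × ℕ → ℕ
    half-difference (t , s) = ⌊ t ∸ s /2⌋

    pair-view : ∀ {p} → p ∈ pairs → ∃₂ λ d y → p ≡ pair d y × HalfPair a b K n d y
    pair-view {t , s} p∈
      with cond@(_ , s<t , eq , _) ← proj₂ (∈-filter⁻ pair-cond? {xs = μ-candidates n} p∈)
      with d , y , refl ← t*t≡s*s+4*n⇒pair n-odd s<t eq =
      d , y , refl , μ-cond⇒HalfPair {a} {b} {K} cond

    [t∸s]^ℓ≡2^ℓ*half-difference^ℓ : ∀ ℓ {p} → p ∈ pairs →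
                                    (proj₁ p ∸ proj₂ p) ^ ℓ ≡ 2 ^ ℓ * half-difference p ^ ℓ
    [t∸s]^ℓ≡2^ℓ*half-difference^ℓ ℓ p∈ with d , y , refl , _ ← pair-view p∈ = begin
      (2 * (d + y) ∸ 2 * y) ^ ℓ              ≡⟨ cong (_^ ℓ) (pair-difference d y) ⟩
      (2 * d) ^ ℓ                            ≡⟨ ^-distribʳ-* 2 d ℓ ⟩
      2 ^ ℓ * d ^ ℓ                          ≡⟨ cong (λ x → 2 ^ ℓ * x ^ ℓ) (⌊pair-difference/2⌋ d y) ⟨
      2 ^ ℓ * half-difference (pair d y) ^ ℓ ∎
      where open ≡-Reasoning

    half-difference-injective : ∀ {p p′} → p ∈ pairs → p′ ∈ pairs →
                                half-difference p ≡ half-difference p′ → p ≡ p′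
    half-difference-injective p∈ p′∈ eq
      with d , y , refl , h ← pair-view p∈ | d′ , y′ , refl , h′ ← pair-view p′∈
      with refl ← trans (sym (⌊pair-difference/2⌋ d y)) (trans eq (⌊pair-difference/2⌋ d′ y′)) =
      cong (pair d) (d*[d+2*y]-injective d {{HalfPair⇒nonZero h}} (trans (sym (HalfPair.n≡ h)) (HalfPair.n≡ h′)))

    half-difference-into : ∀ {p} → p ∈ pairs → half-difference p ∈ divisors
    half-difference-into p∈ with d , y , refl , h ← pair-view p∈ =
      subst (_∈ divisors) (sym (⌊pair-difference/2⌋ d y))
        (∈-filter⁺ divisor-cond? (∈-upTo⁺ (s≤s (∣⇒≤ (proj₁ (proj₂ cond))))) cond)
      where cond = HalfPair⇒div-cond h

    half-difference-onto : (+ n) ≡ a ℤ.* a ℤ.- b ℤ.* b [mod F ] →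
                           ∀ {d} → d ∈ divisors → ∃[ p ] p ∈ pairs × half-difference p ≡ d
    half-difference-onto n≡a*a-b*b {d} d∈
      with y , h ← div-cond⇒HalfPair F-sq {a} {b} n⊥2K n≡a*a-b*b
                     (proj₂ (∈-filter⁻ divisor-cond? {xs = upTo (suc n)} d∈)) =
      pair d y , ∈-filter⁺ pair-cond? (∈-μ-candidates {n} s<t (pair-bound h)) cond , ⌊pair-difference/2⌋ d y
      where
      cond = HalfPair⇒μ-cond h
      s<t = proj₁ (proj₂ cond)

  μ-even-residue≡divSum : ∀ ℓ → (+ n) ≡ a ℤ.* a ℤ.- b ℤ.* b [mod F ] →
                          μ ℓ (+ 2 ℤ.* a) (+ 2 ℤ.* b) (2 * K) n ≡ 2 ^ ℓ * divSum ℓ n (a ℤ.- b) K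
  μ-even-residue≡divSum ℓ n≡a*a-b*b = begin
    sum (map (λ p → (proj₁ p ∸ proj₂ p) ^ ℓ) pairs)
      ≡⟨ cong sum (map-cong-local (All.tabulate ([t∸s]^ℓ≡2^ℓ*half-difference^ℓ ℓ))) ⟩
    sum (map ((λ d → 2 ^ ℓ * d ^ ℓ) ∘ half-difference) pairs)
      ≡⟨ sum-map-reindex half-difference _ Unique-pairs Unique-divisors
           half-difference-injective half-difference-into (half-difference-onto n≡a*a-b*b) ⟩
    sum (map (λ d → 2 ^ ℓ * d ^ ℓ) divisors)
      ≡⟨ *-distribˡ-sum (2 ^ ℓ) (_^ ℓ) divisors ⟨
    2 ^ ℓ * divSum ℓ n (a ℤ.- b) K
      ∎
    where open ≡-Reasoning

  μ-non-residue≡0 : ∀ ℓ → ¬ ((+ n) ≡ a ℤ.* a ℤ.- b ℤ.* b [mod F ]) →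
                    μ ℓ (+ 2 ℤ.* a) (+ 2 ℤ.* b) (2 * K) n ≡ 0
  μ-non-residue≡0 ℓ n≢a*a-b*b = no-μ-pair⇒μ≡0 ℓ (+ 2 ℤ.* a) (+ 2 ℤ.* b) (2 * K) n no-pair
    where
    no-pair : ∀ {p} → ¬ μ-cond (+ 2 ℤ.* a) (+ 2 ℤ.* b) (2 * K) n p
    no-pair cond@(_ , s<t , eq , _) with d , y , refl ← t*t≡s*s+4*n⇒pair n-odd s<t eq =
      n≢a*a-b*b (HalfPair⇒n≡a*a-b*b F-sq {a} {b} (μ-cond⇒HalfPair {a} {b} {K} {n} {d} {y} cond))

lemma3p1 : (ℓ : ℕ) (a b : ℤ) (e M₁ M n : ℕ) →
    1 ≤ e → ¬ (ℕD._∣_ 2 M₁) → 1 ≤ M₁ → M ≡ 2 ^ e ℕ.* M₁ →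
    1 ≤ n → gcd n M ≡ 1 →
    ((¬ (ℤD._∣_ (+ 2) a) ⊎ ¬ (ℤD._∣_ (+ 2) b)) → μ ℓ a b M n ≡ 0)
    × ((a₁ b₁ : ℤ) → a ≡ + 2 ℤ.* a₁ → b ≡ + 2 ℤ.* b₁ →
        ((+ n) ≡ a₁ ℤ.* a₁ ℤ.- b₁ ℤ.* b₁ [mod 2 ^ fexp e ℕ.* M₁ ] →
          μ ℓ a b M n ≡ 2 ^ ℓ ℕ.* divSum ℓ n (a₁ ℤ.- b₁) (2 ^ (e ℕ.∸ 1) ℕ.* M₁))
        × (¬ ((+ n) ≡ a₁ ℤ.* a₁ ℤ.- b₁ ℤ.* b₁ [mod 2 ^ fexp e ℕ.* M₁ ]) →
          μ ℓ a b M n ≡ 0))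
lemma3p1 ℓ a b (suc e) M₁ M n (s≤s z≤n) M₁-odd _ M≡2^e*M₁ _ gcd[n,M]≡1
  with refl ← trans M≡2^e*M₁ (*-assoc 2 (2 ^ e) M₁) =
  let n⊥2K = gcd≡1⇒coprime gcd[n,M]≡1
      F-sq = SquareModulus-2^e*M₁ e M₁-odd
  in  μ-odd-residue≡0 {2 ^ e * M₁} n⊥2K ℓ a b ,
      λ where a₁ b₁ refl refl →
                μ-even-residue≡divSum F-sq n⊥2K a₁ b₁ ℓ , μ-non-residue≡0 F-sq n⊥2K a₁ b₁ ℓ
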